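{- Every betweenness algebra is a weak betweenness algebra.
   Context: Let $A$ be a non-trivial Boolean algebra with operations $+,\cdot,-$ and constants $0,1$. A binary possibility operator is $f:A^2\to A$ with $f(0,y)=f(x,0)=0$ and additive in each argument: $f(x+x',y)=f(x,y)+f(x',y)$, $f(x,y+y')=f(x,y)+f(x,y')$. A binary sufficiency operator is $g:A^2\to A$ with $g(0,y)=g(x,0)=1$ and $g(x+x',y)=g(x,y)\cdot g(x',y)$, $g(x,y+y')=g(x,y)\cdot g(x,y')$. A PS-algebra is $\langle A,f,g\rangle$ with such $f,g$. Consider the axioms (for all $x,y,z$): (ABT0) $x\le f(x,x)$; (ABT1$_f$) $f(x,y)\le f(y,x)$; (ABT1$_g$) $g(x,y)\le g(y,x)$; (ABT2) $y\cdot f(x,z)\le f(x\cdot f(x,y),z)$; (ABT3) $f(x,g(x,-y)\cdot y)\le y$; (wMIA) $x\ne0\wedge y\ne 0\rightarrow g(x,y)\le f(x,y)$; (ABTW) $x\ne 0\rightarrow g(x,x)\le x$. A betweenness algebra is a PS-algebra satisfying (ABT0), (ABT1$_f$), (ABT1$_g$), (ABT2), (ABT3), (wMIA). A weak betweenness algebra is a PS-algebra satisfying (ABT0), (ABT1$_f$), (ABT1$_g$), (ABT2) and (ABTW). -}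

module Defs where

open import Level using (Level; _⊔_)
open import Data.Product using (_×_)
open import Relation.Nullary using (¬_)
open import Algebra.Lattice.Bundles using (BooleanAlgebra)

-- Everything is relative to a Boolean algebra A (stdlib bundle, setoid equality ≈).
-- Notation: + is ∨, · is ∧, - is the Boolean complement (stdlib ¬_, renamed -_), 0 is ⊥, 1 is ⊤.
module _ {c ℓ : Level} (A : BooleanAlgebra c ℓ) where
  open BooleanAlgebra A renaming (¬_ to -_)

  _≤ᴮ_ : Carrier → Carrier → Set ℓ
  x ≤ᴮ y = (x ∧ y) ≈ x

  NonTrivial : Set ℓ
  NonTrivial = ¬ (⊤ ≈ ⊥)

  record IsPossibility (f : Carrier → Carrier → Carrier) : Set (c ⊔ ℓ) where
    field
      cong   : ∀ {x x′ y y′} → x ≈ x′ → y ≈ y′ → f x y ≈ f x′ y′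
      zeroˡ  : ∀ y → f ⊥ y ≈ ⊥
      zeroʳ  : ∀ x → f x ⊥ ≈ ⊥
      additiveˡ : ∀ x x′ y → f (x ∨ x′) y ≈ (f x y ∨ f x′ y)
      additiveʳ : ∀ x y y′ → f x (y ∨ y′) ≈ (f x y ∨ f x y′)

  record IsSufficiency (g : Carrier → Carrier → Carrier) : Set (c ⊔ ℓ) where
    field
      cong   : ∀ {x x′ y y′} → x ≈ x′ → y ≈ y′ → g x y ≈ g x′ y′
      oneˡ   : ∀ y → g ⊥ y ≈ ⊤
      oneʳ   : ∀ x → g x ⊥ ≈ ⊤
      multiplicativeˡ : ∀ x x′ y → g (x ∨ x′) y ≈ (g x y ∧ g x′ y)
      multiplicativeʳ : ∀ x y y′ → g x (y ∨ y′) ≈ (g x y ∧ g x y′)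

  record IsPSAlgebra (f g : Carrier → Carrier → Carrier) : Set (c ⊔ ℓ) where
    field
      nonTrivial    : NonTrivial
      isPossibility : IsPossibility f
      isSufficiency : IsSufficiency g

  module _ (f g : Carrier → Carrier → Carrier) where
    ABT0 : Set (c ⊔ ℓ)
    ABT0 = ∀ x → x ≤ᴮ f x x

    ABT1f : Set (c ⊔ ℓ)
    ABT1f = ∀ x y → f x y ≤ᴮ f y x

    ABT1g : Set (c ⊔ ℓ)
    ABT1g = ∀ x y → g x y ≤ᴮ g y x

    ABT2 : Set (c ⊔ ℓ)
    ABT2 = ∀ x y z → (y ∧ f x z) ≤ᴮ f (x ∧ f x y) z

    ABT3 : Set (c ⊔ ℓ)
    ABT3 = ∀ x y → f x (g x (- y) ∧ y) ≤ᴮ y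

    wMIA : Set (c ⊔ ℓ)
    wMIA = ∀ x y → ¬ (x ≈ ⊥) → ¬ (y ≈ ⊥) → g x y ≤ᴮ f x y

    ABTW : Set (c ⊔ ℓ)
    ABTW = ∀ x → ¬ (x ≈ ⊥) → g x x ≤ᴮ x

    record IsBetweennessAlgebra : Set (c ⊔ ℓ) where
      field
        isPSAlgebra : IsPSAlgebra f g
        abt0  : ABT0
        abt1f : ABT1f
        abt1g : ABT1g
        abt2  : ABT2
        abt3  : ABT3
        wmia  : wMIA

    record IsWeakBetweennessAlgebra : Set (c ⊔ ℓ) where
      field
        isPSAlgebra : IsPSAlgebra f g
        abt0  : ABT0
        abt1f : ABT1f
        abt1g : ABT1g
        abt2  : ABT2
        abtw  : ABTW

{-# OPTIONS --safe #-}
-- Put z = g(x,x)·-x.  ABT3 at y = -x gives f(x,z) ≤ -x, i.e. x·f(x,z) = 0, and then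
-- ABT2 gives z·f(x,x) ≤ f(x·f(x,z), x) = f(0,x) = 0.  For x ≠ 0, wMIA gives
-- g(x,x) ≤ f(x,x), so z = z·f(x,x) = 0, which is g(x,x) ≤ x.
module Submission where

open import Defs
open import Level using (Level)
open import Algebra.Lattice.Bundles using (BooleanAlgebra)
import Algebra.Lattice.Properties.BooleanAlgebra as BooleanAlgebraProperties
import Relation.Binary.Reasoning.Setoid as SetoidReasoning

module _ {c ℓ : Level} (A : BooleanAlgebra c ℓ) where
  open BooleanAlgebra A renaming (¬_ to -_)
  open BooleanAlgebraProperties A using (¬-involutive; ∧-zeroˡ; ∧-zeroʳ; ∨-identityʳ; ∧-identityʳ)
  open SetoidReasoning setoid

  private
    infix 4 _≤_
    _≤_ : Carrier → Carrier → Set ℓ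
    _≤_ = _≤ᴮ_ A

  ≤-¬⇒disjoint : ∀ a b → a ≤ - b → (b ∧ a) ≈ ⊥
  ≤-¬⇒disjoint a b a≤-b = begin
    b ∧ a         ≈⟨ ∧-congˡ (sym a≤-b) ⟩
    b ∧ (a ∧ - b) ≈⟨ ∧-congˡ (∧-comm a (- b)) ⟩
    b ∧ (- b ∧ a) ≈⟨ sym (∧-assoc b (- b) a) ⟩
    (b ∧ - b) ∧ a ≈⟨ ∧-congʳ (∧-complementʳ b) ⟩
    ⊥ ∧ a         ≈⟨ ∧-zeroˡ a ⟩
    ⊥             ∎

  ∧-¬≈⊥⇒≤ : ∀ a b → (a ∧ - b) ≈ ⊥ → a ≤ b
  ∧-¬≈⊥⇒≤ a b a∧-b≈⊥ = begin
    a ∧ b               ≈⟨ sym (∨-identityʳ (a ∧ b)) ⟩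
    (a ∧ b) ∨ ⊥         ≈⟨ ∨-congˡ (sym a∧-b≈⊥) ⟩
    (a ∧ b) ∨ (a ∧ - b) ≈⟨ sym (∧-distribˡ-∨ a b (- b)) ⟩
    a ∧ (b ∨ - b)       ≈⟨ ∧-congˡ (∨-complementʳ b) ⟩
    a ∧ ⊤               ≈⟨ ∧-identityʳ a ⟩
    a                   ∎

  ≤-disjoint⇒∧-disjoint : ∀ a b d → a ≤ b → ((a ∧ d) ∧ b) ≈ ⊥ → (a ∧ d) ≈ ⊥
  ≤-disjoint⇒∧-disjoint a b d a≤b a∧d∧b≈⊥ = begin
    a ∧ d       ≈⟨ ∧-congʳ (sym a≤b) ⟩
    (a ∧ b) ∧ d ≈⟨ ∧-assoc a b d ⟩
    a ∧ (b ∧ d) ≈⟨ ∧-congˡ (∧-comm b d) ⟩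
    a ∧ (d ∧ b) ≈⟨ ∧-assoc a d b ⟨
    (a ∧ d) ∧ b ≈⟨ a∧d∧b≈⊥ ⟩
    ⊥           ∎

  module _ {f g : Carrier → Carrier → Carrier}
           (possibility : IsPossibility A f) (sufficiency : IsSufficiency A g) where
    private
      module P = IsPossibility possibility
      module S = IsSufficiency sufficiency

    abt2⇒disjoint-f : ABT2 A f g → ∀ x y z → (x ∧ f x z) ≈ ⊥ → (z ∧ f x y) ≈ ⊥
    abt2⇒disjoint-f abt2 x y z x∧fxz≈⊥ = begin
      z ∧ f x y                     ≈⟨ abt2 x z y ⟨
      (z ∧ f x y) ∧ f (x ∧ f x z) y ≈⟨ ∧-congˡ (P.cong x∧fxz≈⊥ refl) ⟩
      (z ∧ f x y) ∧ f ⊥ y           ≈⟨ ∧-congˡ (P.zeroˡ y) ⟩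
      (z ∧ f x y) ∧ ⊥               ≈⟨ ∧-zeroʳ _ ⟩
      ⊥                             ∎

    abt3⇒disjoint-f : ABT3 A f g → ∀ x y → (y ∧ f x (g x y ∧ - y)) ≈ ⊥
    abt3⇒disjoint-f abt3 x y = ≤-¬⇒disjoint (f x (g x y ∧ - y)) y (begin
      f x (g x y ∧ - y) ∧ - y       ≈⟨ ∧-congʳ (P.cong refl (∧-congʳ g-y≈gy)) ⟨
      f x (g x (- - y) ∧ - y) ∧ - y ≈⟨ abt3 x (- y) ⟩
      f x (g x (- - y) ∧ - y)       ≈⟨ P.cong refl (∧-congʳ g-y≈gy) ⟩
      f x (g x y ∧ - y)             ∎)
      where
      g-y≈gy : g x (- - y) ≈ g x y
      g-y≈gy = S.cong refl (¬-involutive y)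

    abt2∧abt3∧wMIA⇒abtw : ABT2 A f g → ABT3 A f g → wMIA A f g → ABTW A f g
    abt2∧abt3∧wMIA⇒abtw abt2 abt3 wmia x x≉⊥ = ∧-¬≈⊥⇒≤ (g x x) x
      (≤-disjoint⇒∧-disjoint (g x x) (f x x) (- x) (wmia x x x≉⊥ x≉⊥)
        (abt2⇒disjoint-f abt2 x x (g x x ∧ - x) (abt3⇒disjoint-f abt3 x x)))

proposition6p4 : {c ℓ : Level} (A : BooleanAlgebra c ℓ)
    (f g : BooleanAlgebra.Carrier A → BooleanAlgebra.Carrier A → BooleanAlgebra.Carrier A) →
      IsBetweennessAlgebra A f g → IsWeakBetweennessAlgebra A f g
proposition6p4 A f g betweenness = record
  { isPSAlgebra = isPSAlgebra
  ; abt0        = abt0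
  ; abt1f       = abt1f
  ; abt1g       = abt1g
  ; abt2        = abt2
  ; abtw        = abt2∧abt3∧wMIA⇒abtw A isPossibility isSufficiency abt2 abt3 wmia
  }
  where
  open IsBetweennessAlgebra betweenness
  open IsPSAlgebra isPSAlgebra
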